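{- Let $a,b,k$ be non-negative integers with $2a+2b\le k$. Let $\mathcal{Y}^e_{a,b,k}$ be the set of generalised frequency sequences $(f_i)_{i\in\mathbb Z}$ such that $f_i+f_{i+1}\le k$ for all $i\ge0$, $f_i=0$ for all $i<0$, $f_0\in\{2(\ell+\max\{\ell-(a-b),0\}):0\le\ell\le a\}$, and $f_i$ is even whenever $i$ is even. Let $\mathcal{Z}^e_{a,b,k}$ be the set of generalised frequency sequences $(f_i)_{i\in\mathbb Z}$ such that $f_i+f_{i+1}\le k$ for all $i\ge0$, $f_i=0$ for all $i<0$, $f_0\le 2a$ and $2f_0+f_1\le k-2b+2a$, and $f_i$ is even whenever $i$ is even. Then there exists a weight-preserving bijection between $\mathcal{Y}^e_{a,b,k}$ and $\mathcal{Z}^e_{a,b,k}$.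
   Context: A generalised frequency sequence is a sequence $(f_i)_{i\in\mathbb Z}$ of non-negative integers with finitely many non-zero terms ($f_i$ = multiplicity of the part $i$), of weight $|f|=\sum_i if_i$. -}

module Defs where

open import Data.Nat using (ℕ; zero; suc; _+_; _*_; _∸_; _≤_)
open import Data.Nat.Divisibility using (_∣_)
open import Data.Integer as ℤ using (ℤ; +_)
open import Data.Bool using (Bool; true; false)
open import Data.List using (List; []; _∷_)
open import Data.Product using (Σ; ∃; ∃-syntax; _×_; _,_; proj₁)
open import Relation.Binary.PropositionalEquality using (_≡_)

-- A list of naturals "has no trailing zero" (its last entry, if any, is non-zero).
-- Stated as a Bool so that proofs of it are unique.
noTrailingZero : List ℕ → Bool
noTrailingZero []            = true
noTrailingZero (zero ∷ [])   = false
noTrailingZero (suc _ ∷ [])  = true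
noTrailingZero (_ ∷ y ∷ ys)  = noTrailingZero (y ∷ ys)

Trimmed : Set
Trimmed = Σ (List ℕ) (λ xs → noTrailingZero xs ≡ true)

-- A generalised frequency sequence (f_i)_{i ∈ ℤ}:
--   first component  : (f_{-1}, f_{-2}, f_{-3}, …)  (negative parts)
--   second component : (f_0, f_1, f_2, …)           (non-negative parts)
-- each represented canonically as a list without trailing zeros
-- (so there are finitely many non-zero terms and equality of sequences
-- is propositional equality).
GFS : Set
GFS = Trimmed × Trimmed

at : List ℕ → ℕ → ℕ
at []       _       = 0
at (x ∷ _)  zero    = x
at (_ ∷ xs) (suc i) = at xs i

pos : GFS → ℕ → ℕ
pos (_ , (xs , _)) i = at xs i

-- f_{-(j+1)} for j ≥ 0
neg : GFS → ℕ → ℕ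
neg ((xs , _) , _) j = at xs j

wsum : ℕ → List ℕ → ℕ
wsum _ []       = 0
wsum s (x ∷ xs) = s * x + wsum (suc s) xs

-- weight |f| = Σ_{i ∈ ℤ} i f_i
weight : GFS → ℤ
weight ((ns , _) , (ps , _)) = + wsum 0 ps ℤ.- + wsum 1 ns

Common : ℕ → GFS → Set
Common k f =
    (∀ i → pos f i + pos f (suc i) ≤ k)
  × (∀ j → neg f j ≡ 0)
  × (∀ i → 2 ∣ i → 2 ∣ pos f i)

-- 𝒴^e_{a,b,k}; note max{ℓ-(a-b),0} = (ℓ + b) ∸ a
Ye : ℕ → ℕ → ℕ → GFS → Set
Ye a b k f =
    Common k f
  × (∃[ ℓ ] (ℓ ≤ a × pos f 0 ≡ 2 * (ℓ + ((ℓ + b) ∸ a))))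

-- 𝒵^e_{a,b,k}; since 2a+2b ≤ k, k-2b+2a = (k ∸ 2b) + 2a
Ze : ℕ → ℕ → ℕ → GFS → Set
Ze a b k f =
    Common k f
  × pos f 0 ≤ 2 * a
  × 2 * pos f 0 + pos f 1 ≤ (k ∸ 2 * b) + 2 * a

WeightPreservingBijection : (GFS → Set) → (GFS → Set) → Set
WeightPreservingBijection P Q =
  Σ (GFS → GFS) λ φ → ( (∀ f → P f → Q (φ f))
         × (∀ f → P f → weight (φ f) ≡ weight f)
         × (∀ f g → P f → P g → φ f ≡ φ g → f ≡ g)
         × (∀ g → Q g → Σ GFS λ f → (P f × φ f ≡ g)) )

{-# OPTIONS --safe #-}
module Submission where

-- The part 0 carries no weight and f₀ is tied to the other entries only through f₀ + f₁ ≤ k,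
-- so it suffices to replace f₀ = F ℓ, where F ℓ = 2(ℓ + max{ℓ - (a - b), 0}) (yHead a b ℓ
-- below), by 2ℓ and keep every other entry.  Both F and ℓ ↦ 2ℓ are strictly increasing, so
-- ℓ can be read back off f₀ in either direction.  Since F ℓ = max{2ℓ, 4ℓ + 2b - 2a}, the
-- condition F ℓ + f₁ ≤ k says exactly that 2ℓ + f₁ ≤ k and 4ℓ + f₁ ≤ k - 2b + 2a, which
-- together with 2ℓ ≤ 2a are the conditions that 𝒵 imposes.

open import Defs
open import Axiom.UniquenessOfIdentityProofs using (module Decidable⇒UIP)
open import Data.Bool using (true)
import Data.Bool.Properties as Bool
import Data.Integer as ℤ
open import Data.List using (List; []; _∷_)
open import Data.Nat
open import Data.Nat.Divisibility using (_∣_; divides; m∣m*n)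
open import Data.Nat.Properties
open import Data.Nat.Tactic.RingSolver using (solve-∀)
open import Data.Sum using (inj₁; inj₂)
open import Data.Product using (∃-syntax; _×_; _,_)
open import Data.Product.Function.NonDependent.Propositional using (_×-⇔_)
open import Function.Bundles using (_⇔_; mk⇔; Equivalence)
import Function.Properties.Equivalence as ⇔
open import Function.Base using (_∋_)
open import Function.Definitions using (Injective)
open import Relation.Binary.Definitions using (Monotonic₁; tri<; tri≈; tri>)
open import Relation.Binary.PropositionalEquality
open import Relation.Nullary using (yes; no; contradiction)

open Equivalence using (to; from)

module _ {f : ℕ → ℕ} (f-mono : Monotonic₁ _<_ _<_ f) where

  strictlyIncreasing⇒inflationary : ∀ n → n ≤ f n
  strictlyIncreasing⇒inflationary zero    = z≤n
  strictlyIncreasing⇒inflationary (suc n) =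
    ≤-trans (s≤s (strictlyIncreasing⇒inflationary n)) (f-mono (n<1+n n))

  strictlyIncreasing⇒injective : Injective _≡_ _≡_ f
  strictlyIncreasing⇒injective {m} {n} fm≡fn with <-cmp m n
  ... | tri< m<n _ _ = contradiction fm≡fn (<⇒≢ (f-mono m<n))
  ... | tri≈ _ m≡n _ = m≡n
  ... | tri> _ _ n<m = contradiction (sym fm≡fn) (<⇒≢ (f-mono n<m))

-- The largest ℓ ≤ m with f ℓ ≡ n, and 0 if there is none.
searchDown : (ℕ → ℕ) → ℕ → ℕ → ℕ
searchDown f n zero = zero
searchDown f n (suc m) with f (suc m) ≟ n
... | yes _ = suc m
... | no _  = searchDown f n m

preimage : (ℕ → ℕ) → ℕ → ℕ
preimage f n = searchDown f n n

searchDown-correct : ∀ {f} → Injective _≡_ _≡_ f →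
                     ∀ {n ℓ} m → f ℓ ≡ n → ℓ ≤ m → searchDown f n m ≡ ℓ
searchDown-correct f-inj zero    _    ℓ≤0 = sym (n≤0⇒n≡0 ℓ≤0)
searchDown-correct {f} f-inj {n} {ℓ} (suc m) fℓ≡n ℓ≤1+m with f (suc m) ≟ n
... | yes fm≡n = f-inj (trans fm≡n (sym fℓ≡n))
... | no  fm≢n = searchDown-correct f-inj m fℓ≡n (<⇒≤pred (≤∧≢⇒< ℓ≤1+m ℓ≢1+m))
  where
  ℓ≢1+m : ℓ ≢ suc m
  ℓ≢1+m refl = fm≢n fℓ≡n

preimage-inverseˡ : ∀ {f} → Monotonic₁ _<_ _<_ f → ∀ ℓ → preimage f (f ℓ) ≡ ℓ
preimage-inverseˡ f-mono ℓ = searchDown-correct (strictlyIncreasing⇒injective f-mono)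
  _ refl (strictlyIncreasing⇒inflationary f-mono ℓ)

trimmedSingleton : ℕ → List ℕ
trimmedSingleton zero    = []
trimmedSingleton (suc x) = suc x ∷ []

setHead : ℕ → List ℕ → List ℕ
setHead x []           = trimmedSingleton x
setHead x (_ ∷ [])     = trimmedSingleton x
setHead x (_ ∷ y ∷ ys) = x ∷ y ∷ ys

noTrailingZero-setHead : ∀ x xs → noTrailingZero xs ≡ true → noTrailingZero (setHead x xs) ≡ true
noTrailingZero-setHead zero    []           _ = refl
noTrailingZero-setHead (suc x) []           _ = refl
noTrailingZero-setHead zero    (_ ∷ [])     _ = refl
noTrailingZero-setHead (suc x) (_ ∷ [])     _ = refl
noTrailingZero-setHead zero    (zero  ∷ _ ∷ _) p = p
noTrailingZero-setHead zero    (suc _ ∷ _ ∷ _) p = p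
noTrailingZero-setHead (suc x) (zero  ∷ _ ∷ _) p = p
noTrailingZero-setHead (suc x) (suc _ ∷ _ ∷ _) p = p

at-setHead-zero : ∀ x xs → at (setHead x xs) 0 ≡ x
at-setHead-zero zero    []           = refl
at-setHead-zero (suc x) []           = refl
at-setHead-zero zero    (_ ∷ [])     = refl
at-setHead-zero (suc x) (_ ∷ [])     = refl
at-setHead-zero x       (_ ∷ y ∷ ys) = refl

at-setHead-suc : ∀ x xs i → at (setHead x xs) (suc i) ≡ at xs (suc i)
at-setHead-suc zero    []           i = refl
at-setHead-suc (suc x) []           i = refl
at-setHead-suc zero    (_ ∷ [])     i = refl
at-setHead-suc (suc x) (_ ∷ [])     i = refl
at-setHead-suc x       (_ ∷ y ∷ ys) i = refl

wsum-setHead : ∀ x xs → wsum 0 (setHead x xs) ≡ wsum 0 xs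
wsum-setHead zero    []           = refl
wsum-setHead (suc x) []           = refl
wsum-setHead zero    (_ ∷ [])     = refl
wsum-setHead (suc x) (_ ∷ [])     = refl
wsum-setHead x       (_ ∷ y ∷ ys) = refl

setHead-setHead : ∀ x y xs → setHead x (setHead y xs) ≡ setHead x xs
setHead-setHead zero    zero    []           = refl
setHead-setHead zero    (suc y) []           = refl
setHead-setHead (suc x) zero    []           = refl
setHead-setHead (suc x) (suc y) []           = refl
setHead-setHead zero    zero    (_ ∷ [])     = refl
setHead-setHead zero    (suc y) (_ ∷ [])     = refl
setHead-setHead (suc x) zero    (_ ∷ [])     = refl
setHead-setHead (suc x) (suc y) (_ ∷ [])     = refl
setHead-setHead x       y       (_ ∷ _ ∷ _)  = refl

setHead-at-zero : ∀ xs → noTrailingZero xs ≡ true → setHead (at xs 0) xs ≡ xs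
setHead-at-zero []           _ = refl
setHead-at-zero (suc x ∷ []) _ = refl
setHead-at-zero (x ∷ y ∷ ys) _ = refl

Trimmed-≡ : ∀ {xs ys p q} → xs ≡ ys → (Trimmed ∋ (xs , p)) ≡ (ys , q)
Trimmed-≡ {p = p} {q} refl = cong (_ ,_) (Decidable⇒UIP.≡-irrelevant Bool._≟_ p q)

setPos₀ : ℕ → GFS → GFS
setPos₀ x (ns , (ps , p)) = ns , (setHead x ps , noTrailingZero-setHead x ps p)

pos-setPos₀-zero : ∀ x f → pos (setPos₀ x f) 0 ≡ x
pos-setPos₀-zero x (_ , (ps , _)) = at-setHead-zero x ps

pos-setPos₀-suc : ∀ x f i → pos (setPos₀ x f) (suc i) ≡ pos f (suc i)
pos-setPos₀-suc x (_ , (ps , _)) = at-setHead-suc x ps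

weight-setPos₀ : ∀ x f → weight (setPos₀ x f) ≡ weight f
weight-setPos₀ x ((ns , _) , (ps , _)) = cong (λ w → ℤ.+ w ℤ.- ℤ.+ wsum 1 ns) (wsum-setHead x ps)

setPos₀-setPos₀ : ∀ x y f → setPos₀ x (setPos₀ y f) ≡ setPos₀ x f
setPos₀-setPos₀ x y (ns , (ps , _)) = cong (ns ,_) (Trimmed-≡ (setHead-setHead x y ps))

setPos₀-pos₀ : ∀ f → setPos₀ (pos f 0) f ≡ f
setPos₀-pos₀ (ns , (ps , p)) = cong (ns ,_) (Trimmed-≡ (setHead-at-zero ps p))

Common-setPos₀ : ∀ {k} x f → Common k f → 2 ∣ x → x + pos f 1 ≤ k → Common k (setPos₀ x f)
Common-setPos₀ {k} x f (adjacent , negative , even) 2∣x x+f₁≤k = adjacent′ , negative , even′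
  where
  adjacent′ : ∀ i → pos (setPos₀ x f) i + pos (setPos₀ x f) (suc i) ≤ k
  adjacent′ zero    rewrite pos-setPos₀-zero x f | pos-setPos₀-suc x f 0 = x+f₁≤k
  adjacent′ (suc i) rewrite pos-setPos₀-suc x f i | pos-setPos₀-suc x f (suc i) = adjacent (suc i)
  even′ : ∀ i → 2 ∣ i → 2 ∣ pos (setPos₀ x f) i
  even′ zero    _    rewrite pos-setPos₀-zero x f = 2∣x
  even′ (suc i) 2∣1+i rewrite pos-setPos₀-suc x f i = even (suc i) 2∣1+i

relabel₀ : (ℕ → ℕ) → (ℕ → ℕ) → GFS → GFS
relabel₀ P Q f = setPos₀ (Q (preimage P (pos f 0))) f

weight-relabel₀ : ∀ P Q f → weight (relabel₀ P Q f) ≡ weight f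
weight-relabel₀ P Q f = weight-setPos₀ (Q (preimage P (pos f 0))) f

relabel₀-≡ : ∀ {P} → Monotonic₁ _<_ _<_ P → ∀ Q f ℓ → pos f 0 ≡ P ℓ →
             relabel₀ P Q f ≡ setPos₀ (Q ℓ) f
relabel₀-≡ {P} P-mono Q f ℓ f₀≡Pℓ =
  cong (λ n → setPos₀ (Q n) f) (trans (cong (preimage P) f₀≡Pℓ) (preimage-inverseˡ P-mono ℓ))

relabel₀-inverse : ∀ {P Q} → Monotonic₁ _<_ _<_ P → Monotonic₁ _<_ _<_ Q →
                   ∀ f ℓ → pos f 0 ≡ P ℓ → relabel₀ Q P (relabel₀ P Q f) ≡ f
relabel₀-inverse {P} {Q} P-mono Q-mono f ℓ f₀≡Pℓ = begin
  relabel₀ Q P (relabel₀ P Q f)   ≡⟨ cong (relabel₀ Q P) (relabel₀-≡ P-mono Q f ℓ f₀≡Pℓ) ⟩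
  relabel₀ Q P (setPos₀ (Q ℓ) f)  ≡⟨ relabel₀-≡ Q-mono P (setPos₀ (Q ℓ) f) ℓ (pos-setPos₀-zero (Q ℓ) f) ⟩
  setPos₀ (P ℓ) (setPos₀ (Q ℓ) f) ≡⟨ setPos₀-setPos₀ (P ℓ) (Q ℓ) f ⟩
  setPos₀ (P ℓ) f                 ≡⟨ cong (λ n → setPos₀ n f) f₀≡Pℓ ⟨
  setPos₀ (pos f 0) f             ≡⟨ setPos₀-pos₀ f ⟩
  f                               ∎
  where open ≡-Reasoning

inverses⇒weightPreservingBijection :
  ∀ {P Q : GFS → Set} (φ ψ : GFS → GFS) →
  (∀ f → P f → Q (φ f)) → (∀ g → Q g → P (ψ g)) →
  (∀ f → P f → ψ (φ f) ≡ f) → (∀ g → Q g → φ (ψ g) ≡ g) →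
  (∀ f → weight (φ f) ≡ weight f) →
  WeightPreservingBijection P Q
inverses⇒weightPreservingBijection {P} φ ψ P⇒Qφ Q⇒Pψ ψφ≡id φψ≡id φ-weight =
  φ , P⇒Qφ , (λ f _ → φ-weight f) , injective , λ g Qg → ψ g , Q⇒Pψ g Qg , φψ≡id g Qg
  where
  injective : ∀ f g → P f → P g → φ f ≡ φ g → f ≡ g
  injective f g Pf Pg φf≡φg =
    trans (sym (ψφ≡id f Pf)) (trans (cong ψ φf≡φg) (ψφ≡id g Pg))

+-∸-≤-⇔ : ∀ {x y z k} → x + (y ∸ z) ≤ k ⇔ (x ≤ k × x + y ≤ k + z)
+-∸-≤-⇔ {x} {y} {z} {k} = mk⇔ to′ from′
  where
  to′ : x + (y ∸ z) ≤ k → x ≤ k × x + y ≤ k + z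
  to′ h = ≤-trans (m≤m+n x (y ∸ z)) h , (begin
    x + y             ≤⟨ +-monoʳ-≤ x (m≤n+m∸n y z) ⟩
    x + (z + (y ∸ z)) ≡⟨ regroup ⟩
    x + (y ∸ z) + z   ≤⟨ +-monoˡ-≤ z h ⟩
    k + z             ∎)
    where
    open ≤-Reasoning
    regroup : x + (z + (y ∸ z)) ≡ x + (y ∸ z) + z
    regroup = trans (cong (x +_) (+-comm z (y ∸ z))) (sym (+-assoc x (y ∸ z) z))
  from′ : x ≤ k × x + y ≤ k + z → x + (y ∸ z) ≤ k
  from′ (x≤k , x+y≤k+z) with ≤-total y z
  ... | inj₁ y≤z rewrite m≤n⇒m∸n≡0 y≤z | +-identityʳ x = x≤k
  ... | inj₂ z≤y = +-cancelʳ-≤ z (x + (y ∸ z)) k (begin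
    x + (y ∸ z) + z   ≡⟨ +-assoc x (y ∸ z) z ⟩
    x + (y ∸ z + z)   ≡⟨ cong (x +_) (m∸n+n≡m z≤y) ⟩
    x + y             ≤⟨ x+y≤k+z ⟩
    k + z             ∎)
    where open ≤-Reasoning

yHead : ℕ → ℕ → ℕ → ℕ
yHead a b ℓ = 2 * (ℓ + ((ℓ + b) ∸ a))

yHead-strictlyIncreasing : ∀ a b → Monotonic₁ _<_ _<_ (yHead a b)
yHead-strictlyIncreasing a b ℓ<m =
  *-monoʳ-< 2 (+-mono-<-≤ ℓ<m (∸-monoˡ-≤ a (+-monoˡ-≤ b (<⇒≤ ℓ<m))))

yHead-+-≤-⇔ : ∀ a b {k} ℓ x → 2 * b ≤ k →
              yHead a b ℓ + x ≤ k ⇔ (2 * ℓ + x ≤ k × 2 * (2 * ℓ) + x ≤ (k ∸ 2 * b) + 2 * a)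
yHead-+-≤-⇔ a b {k} ℓ x 2b≤k =
  subst (λ n → n ≤ k ⇔ Bounds) (sym split) (⇔.trans +-∸-≤-⇔ (⇔.refl ×-⇔ shift))
  where
  Bounds : Set
  Bounds = 2 * ℓ + x ≤ k × 2 * (2 * ℓ) + x ≤ (k ∸ 2 * b) + 2 * a
  split : yHead a b ℓ + x ≡ (2 * ℓ + x) + (2 * (ℓ + b) ∸ 2 * a)
  split = trans (regroup ℓ ((ℓ + b) ∸ a) x) (cong ((2 * ℓ + x) +_) (*-distribˡ-∸ 2 (ℓ + b) a))
    where
    regroup : ∀ ℓ d x → 2 * (ℓ + d) + x ≡ (2 * ℓ + x) + 2 * d
    regroup = solve-∀
  shift : (2 * ℓ + x) + 2 * (ℓ + b) ≤ k + 2 * a ⇔ 2 * (2 * ℓ) + x ≤ (k ∸ 2 * b) + 2 * a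
  shift = subst₂ (λ m n → m ≤ n ⇔ 2 * (2 * ℓ) + x ≤ (k ∸ 2 * b) + 2 * a) (lhs ℓ x b) rhs
                 (mk⇔ (+-cancelʳ-≤ (2 * b) _ _) (+-monoˡ-≤ (2 * b)))
    where
    lhs : ∀ ℓ x b → 2 * (2 * ℓ) + x + 2 * b ≡ (2 * ℓ + x) + 2 * (ℓ + b)
    lhs = solve-∀
    swap : ∀ u a b → u + 2 * a + 2 * b ≡ u + 2 * b + 2 * a
    swap = solve-∀
    rhs : (k ∸ 2 * b) + 2 * a + 2 * b ≡ k + 2 * a
    rhs = trans (swap (k ∸ 2 * b) a b) (cong (_+ 2 * a) (m∸n+n≡m 2b≤k))

Common⇒pos₀-even : ∀ {k} f → Common k f → ∃[ m ] pos f 0 ≡ 2 * m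
Common⇒pos₀-even f (_ , _ , even) with even 0 (divides 0 refl)
... | divides m f₀≡m*2 = m , trans f₀≡m*2 (*-comm m 2)

module _ (a b : ℕ) {k : ℕ} (2b≤k : 2 * b ≤ k) where

  Ye⇒Ze : ∀ f → Ye a b k f → Ze a b k (relabel₀ (yHead a b) (2 *_) f)
  Ye⇒Ze f (common@(adjacent , _) , ℓ , ℓ≤a , f₀≡yHeadℓ) =
    let 2ℓ+f₁≤k , 4ℓ+f₁≤ = to (yHead-+-≤-⇔ a b ℓ (pos f 1) 2b≤k)
                                (subst (λ n → n + pos f 1 ≤ k) f₀≡yHeadℓ (adjacent 0))
    in subst (Ze a b k) (sym (relabel₀-≡ (yHead-strictlyIncreasing a b) (2 *_) f ℓ f₀≡yHeadℓ))
         ( Common-setPos₀ (2 * ℓ) f common (m∣m*n ℓ) 2ℓ+f₁≤k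
         , subst (_≤ 2 * a) (sym f′₀≡2ℓ) (*-monoʳ-≤ 2 ℓ≤a)
         , subst₂ (λ u v → 2 * u + v ≤ (k ∸ 2 * b) + 2 * a)
                  (sym f′₀≡2ℓ) (sym (pos-setPos₀-suc (2 * ℓ) f 0)) 4ℓ+f₁≤ )
    where
    f′₀≡2ℓ : pos (setPos₀ (2 * ℓ) f) 0 ≡ 2 * ℓ
    f′₀≡2ℓ = pos-setPos₀-zero (2 * ℓ) f

  Ze⇒Ye : ∀ g → Ze a b k g → Ye a b k (relabel₀ (2 *_) (yHead a b) g)
  Ze⇒Ye g (common@(adjacent , _) , g₀≤2a , 4m+g₁≤) with Common⇒pos₀-even g common
  ... | m , g₀≡2m =
    subst (Ye a b k) (sym (relabel₀-≡ (*-monoʳ-< 2) (yHead a b) g m g₀≡2m))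
      ( Common-setPos₀ (yHead a b m) g common (m∣m*n (m + ((m + b) ∸ a))) yHeadm+g₁≤k
      , m , *-cancelˡ-≤ 2 (subst (_≤ 2 * a) g₀≡2m g₀≤2a) , pos-setPos₀-zero (yHead a b m) g )
    where
    yHeadm+g₁≤k : yHead a b m + pos g 1 ≤ k
    yHeadm+g₁≤k = from (yHead-+-≤-⇔ a b m (pos g 1) 2b≤k)
      ( subst (λ n → n + pos g 1 ≤ k) g₀≡2m (adjacent 0)
      , subst (λ n → 2 * n + pos g 1 ≤ (k ∸ 2 * b) + 2 * a) g₀≡2m 4m+g₁≤ )

proposition4p5 : (a b k : ℕ) → 2 * a + 2 * b ≤ k →
    WeightPreservingBijection (Ye a b k) (Ze a b k)
proposition4p5 a b k 2a+2b≤k =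
  inverses⇒weightPreservingBijection
    (relabel₀ (yHead a b) (2 *_)) (relabel₀ (2 *_) (yHead a b))
    (Ye⇒Ze a b 2b≤k) (Ze⇒Ye a b 2b≤k)
    (λ f (_ , ℓ , _ , f₀≡yHeadℓ) → relabel₀-inverse yHead-mono double-mono f ℓ f₀≡yHeadℓ)
    (λ g (common , _) → let m , g₀≡2m = Common⇒pos₀-even g common
                        in relabel₀-inverse double-mono yHead-mono g m g₀≡2m)
    (weight-relabel₀ (yHead a b) (2 *_))
  where
  2b≤k : 2 * b ≤ k
  2b≤k = ≤-trans (m≤n+m (2 * b) (2 * a)) 2a+2b≤k
  yHead-mono : Monotonic₁ _<_ _<_ (yHead a b)
  yHead-mono = yHead-strictlyIncreasing a b
  double-mono : Monotonic₁ _<_ _<_ (2 *_)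
  double-mono = *-monoʳ-< 2
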